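{- Let $t \geq 2$ be an integer and let $H$ be any connected graph with more than $t$ vertices. Then, as $r \to \infty$, \[ f(r,H) \leq (1 + o_r(1))\, \frac{r-1}{t-1}. \]
   Context: Let $r,k$ be positive integers. A graph $G$ is an $(r,k)$-graph if $V(G)$ can be partitioned into sets $V_1,\dots,V_r$ with $|V_i| \le k$ for all $i$ such that for every pair $i \neq j$ in $[r]$ there is an edge of $G$ with one endpoint in $V_i$ and the other in $V_j$. For a graph $H$, $f(r,H)$ is the minimum $k$ such that there exists an $H$-free $(r,k)$-graph. $o_r(1)$ denotes a quantity tending to $0$ as $r \to \infty$ (with $t$ and $H$ fixed). -}

module Defs where

open import Data.Nat using (ℕ; _≤_)
open import Data.Fin using (Fin; _≟_)
open import Data.List using (length; filter; allFin)
open import Data.Product using (Σ; _×_; ∃)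
open import Relation.Nullary using (¬_)
open import Relation.Binary.PropositionalEquality using (_≡_; _≢_)
open import Function.Definitions using (Injective)

record Graph : Set₁ where
  field
    n      : ℕ
    Adj    : Fin n → Fin n → Set
    symAdj : ∀ {u v} → Adj u v → Adj v u
    irrAdj : ∀ {u} → ¬ Adj u u
open Graph public

data Walk (G : Graph) : Fin (n G) → Fin (n G) → Set where
  here : ∀ {u} → Walk G u u
  step : ∀ {u v w} → Adj G u v → Walk G v w → Walk G u w

Connected : Graph → Set
Connected G = ∀ u v → Walk G u v

Contains : Graph → Graph → Set
Contains G H = Σ (Fin (n H) → Fin (n G)) λ φ →
  Injective _≡_ _≡_ φ × (∀ {u v} → Adj H u v → Adj G (φ u) (φ v))

Free : Graph → Graph → Set
Free H G = ¬ Contains G H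

partSize : ∀ {m r} → (Fin m → Fin r) → Fin r → ℕ
partSize {m} p i = length (filter (λ v → p v ≟ i) (allFin m))

IsRKGraph : ℕ → ℕ → Graph → Set
IsRKGraph r k G = Σ (Fin (n G) → Fin r) λ p →
  (∀ i → partSize p i ≤ k) ×
  (∀ i j → i ≢ j → ∃ λ u → ∃ λ v → p u ≡ i × p v ≡ j × Adj G u v)

HasFreeRK : ℕ → Graph → ℕ → Set₁
HasFreeRK r H k = Σ Graph λ G → IsRKGraph r k G × Free H G

IsF : ℕ → Graph → ℕ → Set₁
IsF r H k = HasFreeRK r H k × (∀ k' → HasFreeRK r H k' → k ≤ k')

{-# OPTIONS --safe #-}
module Submission where

-- An H-free (r,k)-graph comes from any cover of the pairs of [r] by blocks of size at most t
-- in which every point lies in k blocks: split each point into k vertices, one per block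
-- through it, and join vertices of different points lying in the same block. Each component
-- then sits inside one block, so it has at most t < |H| vertices. Covers with k ≈ r/(t-1) are
-- built recursively: arrange [r] in t rows of length q ≈ r/t with q ≡ 1 modulo every d < t,
-- cover pairs in distinct rows by the lines x + s·i (mod q) of a transversal design (q blocks
-- per point) and pairs within a row by copies of a cover of [q]. Then k(r) ≤ q + k(q), which sums
-- to r/(t-1) up to lower-order terms.

open import Defs
open import Data.Nat using (ℕ; zero; suc; _≤_; _<_; _*_; _+_; _∸_; _⊓_; _⊔_; z≤n; s≤s; s≤s⁻¹; _%_; _/_; NonZero; _!)
open import Data.Nat.Properties
  using ( ≤-trans; <-≤-trans; ≤-<-trans; <⇒≤; ≤-total; m≤m+n; m≤n+m; n≤1+n
        ; +-comm; +-assoc; *-suc; *-distribˡ-+; +-cancelˡ-≡; +-monoˡ-≤; +-monoʳ-≤; +-monoˡ-<; +-monoʳ-<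
        ; *-monoʳ-≤; *-cancelˡ-≤; *-cancelˡ-<; m∸n≤m; m<n⇒0<n∸m; m+[n∸m]≡n; ≮⇒≥; _<?_
        ; module ≤-Reasoning; m≤n⇒m⊓n≡m; m≥n⇒m⊓n≡n; m≤n⇒m⊔n≡n; m≥n⇒m⊔n≡m; ⊓-comm; ⊔-comm; _!≢0; m*n≢0 )
  renaming (_≟_ to _≟ℕ_)
open import Data.Nat.DivMod using (m≡m%n+[m/n]*n; [m+kn]%n≡m%n; %-distribˡ-+; m%n<n; m<n⇒m%n≡m; m/n*n≤m)
open import Data.Nat.Divisibility using (_∣_; divides; ∣-trans; m∣m*n; n∣m*n; m≤n⇒m!∣n!)
open import Data.Nat.Induction using (<-rec)
open import Data.Nat.Tactic.RingSolver using (solve-∀)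
open import Data.Fin using (Fin; zero; suc; toℕ; fromℕ<; remQuot; combine; splitAt; _↑ˡ_; _↑ʳ_; inject≤; punchOut; _≟_)
open import Data.Fin.Properties
  using ( *↔×; +↔⊎; remQuot-combine; splitAt-↑ˡ; splitAt-↑ʳ; toℕ-injective; toℕ-fromℕ<; toℕ<n
        ; inject≤-injective; punchOut-injective; pigeonhole; <-cmp; <-irrefl )
open import Data.List using (List; []; _∷_; length; filter; allFin)
open import Data.List.Membership.Propositional using (_∈_)
open import Data.List.Membership.Propositional.Properties using (∈-filter⁻)
open import Data.List.Relation.Unary.Any using (here; there)
import Data.List.Relation.Unary.All as All
open import Data.List.Relation.Unary.AllPairs using (_∷_)
open import Data.List.Relation.Unary.Unique.Propositional using (Unique)
open import Data.List.Relation.Unary.Unique.Propositional.Properties using (filter⁺; allFin⁺)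
open import Data.Product using (Σ; _×_; _,_; proj₁; proj₂; ∃; ∃₂; uncurry)
open import Data.Product.Properties using (,-injectiveˡ; ,-injectiveʳ; ×-≡,≡→≡)
open import Data.Sum using (_⊎_; inj₁; inj₂)
import Data.Sum as Sum
open import Data.Sum.Properties using (inj₁-injective; inj₂-injective)
open import Data.Empty using (⊥-elim)
open import Function using (_∘_; _on_)
open import Level using (0ℓ)
open import Function.Bundles using (Injection)
open import Function.Definitions using (Injective)
open import Function.Properties.Inverse using (↔⇒↣)
open import Relation.Binary using (Rel; _⇒_; tri<; tri≈; tri>)
open import Relation.Binary.Construct.Always using (Always)
open import Relation.Binary.Construct.Union using (_∪_)
open import Relation.Nullary using (Dec; yes; no)
open import Relation.Binary.PropositionalEquality

remQuot-injective : ∀ {m} n {i j : Fin (m * n)} → remQuot {m} n i ≡ remQuot n j → i ≡ j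
remQuot-injective n = Injection.injective (↔⇒↣ *↔×)

splitAt-injective : ∀ m {n} {i j : Fin (m + n)} → splitAt m i ≡ splitAt m j → i ≡ j
splitAt-injective m = Injection.injective (↔⇒↣ (+↔⊎ {m}))

Unique⇒length≤ : ∀ {A : Set} {xs : List A} k → Unique xs → (f : ∀ {x} → x ∈ xs → Fin k) →
                 (∀ {x y} (x∈ : x ∈ xs) (y∈ : y ∈ xs) → f x∈ ≡ f y∈ → x ≡ y) → length xs ≤ k
Unique⇒length≤ {xs = []}    _       _               _ _   = z≤n
Unique⇒length≤ {xs = _ ∷ _} zero    _               f _   with f (here refl)
... | ()
Unique⇒length≤ {xs = _ ∷ _} (suc k) (x∉xs ∷ unique) f inj = s≤s (Unique⇒length≤ k unique f′ f′-injective)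
  where
    f-apart : ∀ {y} (y∈ : y ∈ _) → f (here refl) ≢ f (there y∈)
    f-apart y∈ eq = All.lookup x∉xs y∈ (inj (here refl) (there y∈) eq)
    f′ : ∀ {y} → y ∈ _ → Fin k
    f′ y∈ = punchOut (f-apart y∈)
    f′-injective : ∀ {y z} (y∈ : y ∈ _) (z∈ : z ∈ _) → f′ y∈ ≡ f′ z∈ → y ≡ z
    f′-injective y∈ z∈ eq = inj (there y∈) (there z∈) (punchOut-injective (f-apart y∈) (f-apart z∈) eq)

-- Blocks of size at most t (position embeds each block into Fin t); every point lies in the
-- k distinct blocks  block x _ , and any two distinct Covered points share a block.
record PairCover (t : ℕ) (X : Set) (k : ℕ) (Covered : Rel X 0ℓ) : Set₁ where
  field
    Block              : Set
    block              : X → Fin k → Block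
    block-injective    : ∀ {x s s′} → block x s ≡ block x s′ → s ≡ s′
    position           : Block → X → Fin t
    position-injective : ∀ {b x y s s′} → block x s ≡ b → block y s′ ≡ b → position b x ≡ position b y → x ≡ y
    covers             : ∀ x y → x ≢ y → Covered x y → ∃₂ λ s s′ → block x s ≡ block y s′

module CoverGraph {t r k : ℕ} (cover : PairCover t (Fin r) k Always) where
  open PairCover cover

  part : Fin (r * k) → Fin r
  part v = proj₁ (remQuot {r} k v)

  slot : Fin (r * k) → Fin k
  slot v = proj₂ (remQuot {r} k v)

  blockOf : Fin (r * k) → Block
  blockOf v = block (part v) (slot v)

  graph : Graph
  graph = record
    { n      = r * k
    ; Adj    = λ v w → part v ≢ part w × blockOf v ≡ blockOf w
    ; symAdj = λ (v≢w , same) → (λ eq → v≢w (sym eq)) , sym same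
    ; irrAdj = λ (v≢v , _) → v≢v refl
    }

  part-slot-injective : ∀ {v w} → part v ≡ part w → slot v ≡ slot w → v ≡ w
  part-slot-injective p s = remQuot-injective {r} k (×-≡,≡→≡ (p , s))

  partSize≤k : ∀ i → partSize part i ≤ k
  partSize≤k i = Unique⇒length≤ k (filter⁺ inPart? (allFin⁺ (r * k))) (λ {v} _ → slot v) slot-injective
    where
      inPart? : ∀ v → Dec (part v ≡ i)
      inPart? v = part v ≟ i
      slot-injective : ∀ {v w} → v ∈ filter inPart? (allFin _) → w ∈ filter inPart? (allFin _) → slot v ≡ slot w → v ≡ w
      slot-injective v∈ w∈ = part-slot-injective
        (trans (proj₂ (∈-filter⁻ inPart? {xs = allFin _} v∈)) (sym (proj₂ (∈-filter⁻ inPart? {xs = allFin _} w∈))))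

  part-combine : ∀ i s → part (combine i s) ≡ i
  part-combine i s = cong proj₁ (remQuot-combine i s)

  blockOf-combine : ∀ i s → blockOf (combine i s) ≡ block i s
  blockOf-combine i s = cong (uncurry block) (remQuot-combine i s)

  edge-between : ∀ i j → i ≢ j → ∃ λ u → ∃ λ v → part u ≡ i × part v ≡ j × Adj graph u v
  edge-between i j i≢j with covers i j i≢j _
  ... | s , s′ , shared =
    combine i s , combine j s′ , part-combine i s , part-combine j s′ ,
    (λ eq → i≢j (trans (sym (part-combine i s)) (trans eq (part-combine j s′)))) ,
    trans (blockOf-combine i s) (trans shared (sym (blockOf-combine j s′)))

  graph-isRKGraph : IsRKGraph r k graph
  graph-isRKGraph = part , partSize≤k , edge-between

  blockOf-position-injective : ∀ {v w} → blockOf v ≡ blockOf w →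
                               position (blockOf v) (part v) ≡ position (blockOf v) (part w) → v ≡ w
  blockOf-position-injective {v} {w} same pos =
    part-slot-injective same-part (block-injective (trans same (cong (λ x → block x (slot w)) (sym same-part))))
    where
      same-part : part v ≡ part w
      same-part = position-injective refl (sym same) pos

  graph-free : ∀ H → Connected H → t < n H → Free H graph
  graph-free H connected t<n (φ , φ-injective , φ-adj) with pigeonhole t<n (λ u → position (blockOf (φ u)) (part (φ u)))
  ... | u , v , u<v , same-position = <-irrefl (φ-injective (blockOf-position-injective same-block positions)) u<v
    where
      walk-blockOf : ∀ {u v} → Walk H u v → blockOf (φ u) ≡ blockOf (φ v)
      walk-blockOf here         = refl
      walk-blockOf (step uw wv) = trans (proj₂ (φ-adj uw)) (walk-blockOf wv)
      same-block : blockOf (φ u) ≡ blockOf (φ v)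
      same-block = walk-blockOf (connected u v)
      positions : position (blockOf (φ u)) (part (φ u)) ≡ position (blockOf (φ u)) (part (φ v))
      positions = trans same-position (cong (λ b → position b (part (φ v))) (sym same-block))

f≤PairCover : ∀ {t r k k′} H → Connected H → t < n H → IsF r H k → PairCover t (Fin r) k′ Always → k ≤ k′
f≤PairCover H connected t<n (_ , minimal) cover = minimal _ (graph , graph-isRKGraph , graph-free H connected t<n)
  where open CoverGraph cover

module _ {t : ℕ} {X : Set} where

  weaken : ∀ {k} {C C′ : Rel X 0ℓ} → C′ ⇒ C → PairCover t X k C → PairCover t X k C′
  weaken C′⇒C cover = record
    { PairCover cover
    ; covers = λ x y x≢y c′ → covers x y x≢y (C′⇒C c′)
    }
    where open PairCover cover

  restrict : ∀ {Y : Set} {k} {C : Rel X 0ℓ} (ι : Y → X) → Injective _≡_ _≡_ ι → PairCover t X k C → PairCover t Y k (C on ι)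
  restrict ι ι-injective cover = record
    { Block              = Block
    ; block              = block ∘ ι
    ; block-injective    = block-injective
    ; position           = λ b → position b ∘ ι
    ; position-injective = λ x∈b y∈b same → ι-injective (position-injective x∈b y∈b same)
    ; covers             = λ x y x≢y c → covers (ι x) (ι y) (x≢y ∘ ι-injective) c
    }
    where open PairCover cover

  union : ∀ {k₁ k₂} {C₁ C₂ : Rel X 0ℓ} → PairCover t X k₁ C₁ → PairCover t X k₂ C₂ →
          PairCover t X (k₁ + k₂) (C₁ ∪ C₂)
  union {k₁} {k₂} {C₁} {C₂} cover₁ cover₂ = record
    { Block              = B₁.Block ⊎ B₂.Block
    ; block              = λ x s → blockᵤ x (splitAt k₁ s)
    ; block-injective    = λ same → splitAt-injective k₁ (blockᵤ-injective _ _ same)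
    ; position           = positionᵤ
    ; position-injective = λ {_} {_} {_} {s} {s′} → positionᵤ-injective (splitAt k₁ s) (splitAt k₁ s′)
    ; covers             = coversᵤ
    }
    where
      module B₁ = PairCover cover₁
      module B₂ = PairCover cover₂

      blockᵤ : X → Fin k₁ ⊎ Fin k₂ → B₁.Block ⊎ B₂.Block
      blockᵤ x = Sum.map (B₁.block x) (B₂.block x)

      blockᵤ-injective : ∀ {x} s s′ → blockᵤ x s ≡ blockᵤ x s′ → s ≡ s′
      blockᵤ-injective (inj₁ s) (inj₁ s′) same = cong inj₁ (B₁.block-injective (inj₁-injective same))
      blockᵤ-injective (inj₂ s) (inj₂ s′) same = cong inj₂ (B₂.block-injective (inj₂-injective same))
      blockᵤ-injective (inj₁ s) (inj₂ s′) ()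
      blockᵤ-injective (inj₂ s) (inj₁ s′) ()

      positionᵤ : B₁.Block ⊎ B₂.Block → X → Fin t
      positionᵤ = Sum.[ B₁.position , B₂.position ]

      positionᵤ-injective : ∀ {b x y} s s′ → blockᵤ x s ≡ b → blockᵤ y s′ ≡ b →
                            positionᵤ b x ≡ positionᵤ b y → x ≡ y
      positionᵤ-injective (inj₁ s) (inj₁ s′) refl y∈b = B₁.position-injective refl (inj₁-injective y∈b)
      positionᵤ-injective (inj₂ s) (inj₂ s′) refl y∈b = B₂.position-injective refl (inj₂-injective y∈b)
      positionᵤ-injective (inj₁ s) (inj₂ s′) refl ()
      positionᵤ-injective (inj₂ s) (inj₁ s′) refl ()

      blockᵤ-↑ˡ : ∀ x s → blockᵤ x (splitAt k₁ (s ↑ˡ k₂)) ≡ inj₁ (B₁.block x s)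
      blockᵤ-↑ˡ x s = cong (blockᵤ x) (splitAt-↑ˡ k₁ s k₂)

      blockᵤ-↑ʳ : ∀ x s → blockᵤ x (splitAt k₁ (k₁ ↑ʳ s)) ≡ inj₂ (B₂.block x s)
      blockᵤ-↑ʳ x s = cong (blockᵤ x) (splitAt-↑ʳ k₁ k₂ s)

      coversᵤ : ∀ x y → x ≢ y → (C₁ ∪ C₂) x y →
                ∃₂ λ s s′ → blockᵤ x (splitAt k₁ s) ≡ blockᵤ y (splitAt k₁ s′)
      coversᵤ x y x≢y (inj₁ c) with B₁.covers x y x≢y c
      ... | s , s′ , shared =
        s ↑ˡ k₂ , s′ ↑ˡ k₂ , trans (blockᵤ-↑ˡ x s) (trans (cong inj₁ shared) (sym (blockᵤ-↑ˡ y s′)))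
      coversᵤ x y x≢y (inj₂ c) with B₂.covers x y x≢y c
      ... | s , s′ , shared =
        k₁ ↑ʳ s , k₁ ↑ʳ s′ , trans (blockᵤ-↑ʳ x s) (trans (cong inj₂ shared) (sym (blockᵤ-↑ʳ y s′)))

rowwise : ∀ {t k} {I Y : Set} → PairCover t Y k Always → PairCover t (I × Y) k (_≡_ on proj₁)
rowwise {I = I} {Y} cover = record
  { Block              = I × Block
  ; block              = λ x s → proj₁ x , block (proj₂ x) s
  ; block-injective    = block-injective ∘ ,-injectiveʳ
  ; position           = λ b x → position (proj₂ b) (proj₂ x)
  ; position-injective = rowwise-position-injective
  ; covers             = rowwise-covers
  }
  where
    open PairCover cover

    rowwise-position-injective : ∀ {b : I × Block} {x y : I × Y} {s s′} →
      (proj₁ x , block (proj₂ x) s) ≡ b → (proj₁ y , block (proj₂ y) s′) ≡ b →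
      position (proj₂ b) (proj₂ x) ≡ position (proj₂ b) (proj₂ y) → x ≡ y
    rowwise-position-injective refl same pos =
      ×-≡,≡→≡ (sym (,-injectiveˡ same) , position-injective refl (,-injectiveʳ same) pos)

    rowwise-covers : ∀ (x y : I × Y) → x ≢ y → proj₁ x ≡ proj₁ y →
                     ∃₂ λ s s′ → (proj₁ x , block (proj₂ x) s) ≡ (proj₁ y , block (proj₂ y) s′)
    rowwise-covers (i , x) (.i , y) ix≢iy refl with covers x y (ix≢iy ∘ cong (i ,_)) _
    ... | s , s′ , shared = s , s′ , cong (i ,_) shared

⊓+⊔≡+ : ∀ m n → (m ⊓ n) + (m ⊔ n) ≡ m + n
⊓+⊔≡+ m n with ≤-total m n
... | inj₁ m≤n rewrite m≤n⇒m⊓n≡m m≤n | m≤n⇒m⊔n≡n m≤n = refl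
... | inj₂ n≤m rewrite m≥n⇒m⊓n≡n n≤m | m≥n⇒m⊔n≡m n≤m = +-comm n m

≡⊓⊎≡⊔ : ∀ m n → m ≡ m ⊓ n ⊎ m ≡ m ⊔ n
≡⊓⊎≡⊔ m n with ≤-total m n
... | inj₁ m≤n = inj₁ (sym (m≤n⇒m⊓n≡m m≤n))
... | inj₂ n≤m = inj₂ (sym (m≥n⇒m⊔n≡m n≤m))

sortedPair : ℕ → ℕ → ℕ × ℕ
sortedPair m n = m ⊓ n , m ⊔ n

sortedPair-injective : ∀ m {n n′} → sortedPair m n ≡ sortedPair m n′ → n ≡ n′
sortedPair-injective m {n} {n′} same = +-cancelˡ-≡ m _ _ (begin
  m + n                 ≡⟨ ⊓+⊔≡+ m n ⟨
  (m ⊓ n) + (m ⊔ n)     ≡⟨ cong (uncurry _+_) same ⟩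
  (m ⊓ n′) + (m ⊔ n′)   ≡⟨ ⊓+⊔≡+ m n′ ⟩
  m + n′                ∎)
  where open ≡-Reasoning

sortedPair-member : ∀ {b} m n → sortedPair m n ≡ b → m ≡ proj₁ b ⊎ m ≡ proj₂ b
sortedPair-member m n refl = ≡⊓⊎≡⊔ m n

isLower : ∀ {t₀} → ℕ × ℕ → ℕ → Fin (2 + t₀)
isLower (lo , _) m with m ≟ℕ lo
... | yes _ = zero
... | no _  = suc zero

isLower-injective : ∀ {t₀ lo hi m n} → m ≡ lo ⊎ m ≡ hi → n ≡ lo ⊎ n ≡ hi →
                    isLower {t₀} (lo , hi) m ≡ isLower (lo , hi) n → m ≡ n
isLower-injective {lo = lo} {m = m} {n} _ _ _ with m ≟ℕ lo | n ≟ℕ lo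
... | yes m≡lo | yes n≡lo = trans m≡lo (sym n≡lo)
isLower-injective (inj₁ m≡lo) _            _ | no m≢lo | _      = ⊥-elim (m≢lo m≡lo)
isLower-injective _           (inj₁ n≡lo)  _ | _       | no n≢lo = ⊥-elim (n≢lo n≡lo)
isLower-injective (inj₂ m≡hi) (inj₂ n≡hi) _ | no _    | no _    = trans m≡hi (sym n≡hi)

pairCover : ∀ {t₀} n → PairCover (2 + t₀) (Fin n) n Always
pairCover n = record
  { Block              = ℕ × ℕ
  ; block              = λ x s → sortedPair (toℕ x) (toℕ s)
  ; block-injective    = λ {x} → toℕ-injective ∘ sortedPair-injective (toℕ x)
  ; position           = λ b x → isLower b (toℕ x)
  ; position-injective = λ {_} {x} {y} {s} {s′} x∈b y∈b same → toℕ-injective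
                           (isLower-injective (sortedPair-member (toℕ x) (toℕ s) x∈b)
                                              (sortedPair-member (toℕ y) (toℕ s′) y∈b) same)
  ; covers             = λ x y _ _ → y , x , cong₂ _,_ (⊓-comm (toℕ x) (toℕ y)) (⊔-comm (toℕ x) (toℕ y))
  }

module _ {q : ℕ} .{{_ : NonZero q}} where

  %-≡-via-multiples : ∀ {a b} k₁ k₂ → a + k₁ * q ≡ b + k₂ * q → a % q ≡ b % q
  %-≡-via-multiples {a} {b} k₁ k₂ eq = begin
    a % q            ≡⟨ [m+kn]%n≡m%n a k₁ q ⟨
    (a + k₁ * q) % q ≡⟨ cong (_% q) eq ⟩
    (b + k₂ * q) % q ≡⟨ [m+kn]%n≡m%n b k₂ q ⟩
    b % q            ∎
    where open ≡-Reasoning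

  +-congʳ-% : ∀ a b c → a % q ≡ b % q → (a + c) % q ≡ (b + c) % q
  +-congʳ-% a b c eq = begin
    (a + c) % q             ≡⟨ %-distribˡ-+ a c q ⟩
    (a % q + c % q) % q     ≡⟨ cong (λ r → (r + c % q) % q) eq ⟩
    (b % q + c % q) % q     ≡⟨ %-distribˡ-+ b c q ⟨
    (b + c) % q             ∎
    where open ≡-Reasoning

+-cancelʳ-% : ∀ {Q} a b c → (a + c) % suc Q ≡ (b + c) % suc Q → a % suc Q ≡ b % suc Q
+-cancelʳ-% {Q} a b c eq = begin
  a % suc Q                   ≡⟨ [m+kn]%n≡m%n a c (suc Q) ⟨
  (a + c * suc Q) % suc Q     ≡⟨ cong (_% suc Q) (regroup a) ⟩
  (a + c + c * Q) % suc Q     ≡⟨ +-congʳ-% {q = suc Q} (a + c) (b + c) (c * Q) eq ⟩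
  (b + c + c * Q) % suc Q     ≡⟨ cong (_% suc Q) (regroup b) ⟨
  (b + c * suc Q) % suc Q     ≡⟨ [m+kn]%n≡m%n b c (suc Q) ⟩
  b % suc Q                   ∎
  where
    open ≡-Reasoning
    regroup : ∀ a → a + c * suc Q ≡ a + c + c * Q
    regroup a = trans (cong (a +_) (*-suc c Q)) (sym (+-assoc a c (c * Q)))

-- Q ≡ -1 modulo suc Q, so f with f * d ≡ Q inverts -d and the slope s solves s * d ≡ y - x.
slope-solves : ∀ {Q d f} → Q ≡ f * d → ∀ x y j → let s = f * (x + Q * y) % suc Q in
               (x + s * (j + d)) % suc Q ≡ (y + s * j) % suc Q
slope-solves {Q} {d} {f} Q≡fd x y j = %-≡-via-multiples {q = suc Q} (2 * y + h * d) (x + suc Q * y) (begin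
    x + s * (j + d) + (2 * y + h * d) * suc Q   ≡⟨ expand x s j d h y Q ⟩
    x + s * j + (s + h * suc Q) * d + 2 * y * suc Q ≡⟨ cong (λ w → x + s * j + w * d + 2 * y * suc Q) (m≡m%n+[m/n]*n W (suc Q)) ⟨
    x + s * j + W * d + 2 * y * suc Q           ≡⟨ cong (λ w → x + s * j + w + 2 * y * suc Q) W*d≡Q*[x+Qy] ⟩
    x + s * j + Q * (x + Q * y) + 2 * y * suc Q ≡⟨ collect x s j y Q ⟩
    y + s * j + (x + suc Q * y) * suc Q         ∎)
  where
    open ≡-Reasoning
    W s h : ℕ
    W = f * (x + Q * y)
    s = W % suc Q
    h = W / suc Q
    swap : ∀ f x d → f * x * d ≡ f * d * x
    swap = solve-∀
    W*d≡Q*[x+Qy] : W * d ≡ Q * (x + Q * y)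
    W*d≡Q*[x+Qy] = trans (swap f (x + Q * y) d) (cong (_* (x + Q * y)) (sym Q≡fd))
    expand : ∀ x s j d h y Q → x + s * (j + d) + (2 * y + h * d) * suc Q ≡ x + s * j + (s + h * suc Q) * d + 2 * y * suc Q
    expand = solve-∀
    collect : ∀ x s j y Q → x + s * j + Q * (x + Q * y) + 2 * y * suc Q ≡ y + s * j + (x + suc Q * y) * suc Q
    collect = solve-∀

DivisibleBelow : ℕ → ℕ → Set
DivisibleBelow t Q = ∀ {d} → 0 < d → d < t → d ∣ Q

module _ {t Q : ℕ} where

  line : Fin t × Fin (suc Q) → Fin (suc Q) → ℕ × ℕ
  line (i , x) s = (toℕ x + toℕ s * toℕ i) % suc Q , toℕ s

  line-injective : ∀ {i} {x y : Fin (suc Q)} s → line (i , x) s ≡ line (i , y) s → x ≡ y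
  line-injective {i} {x} {y} s same = toℕ-injective (begin
    toℕ x         ≡⟨ m<n⇒m%n≡m (toℕ<n x) ⟨
    toℕ x % suc Q ≡⟨ +-cancelʳ-% (toℕ x) (toℕ y) (toℕ s * toℕ i) (,-injectiveˡ same) ⟩
    toℕ y % suc Q ≡⟨ m<n⇒m%n≡m (toℕ<n y) ⟩
    toℕ y         ∎)
    where open ≡-Reasoning

  line-position-injective : ∀ {b} {p p′ : Fin t × Fin (suc Q)} {s s′} →
                            line p s ≡ b → line p′ s′ ≡ b → proj₁ p ≡ proj₁ p′ → p ≡ p′
  line-position-injective {p = i , x} {.i , y} {s} refl same refl with toℕ-injective (,-injectiveʳ same)
  ... | refl = cong (i ,_) (sym (line-injective s same))

  line-through : DivisibleBelow t Q → ∀ {i j : Fin t} (x y : Fin (suc Q)) → toℕ j < toℕ i →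
                 ∃ λ s → line (i , x) s ≡ line (j , y) s
  line-through divisible {i} {j} x y j<i with divisible (m<n⇒0<n∸m j<i) (≤-<-trans (m∸n≤m (toℕ i) (toℕ j)) (toℕ<n i))
  ... | divides f Q≡fd = s , cong (_, toℕ s) (begin
      (toℕ x + toℕ s * toℕ i) % suc Q             ≡⟨ cong₂ (λ a b → (toℕ x + a * b) % suc Q) toℕ-s (sym i≡j+d) ⟩
      (toℕ x + slope * (toℕ j + d)) % suc Q       ≡⟨ slope-solves {f = f} Q≡fd (toℕ x) (toℕ y) (toℕ j) ⟩
      (toℕ y + slope * toℕ j) % suc Q             ≡⟨ cong (λ a → (toℕ y + a * toℕ j) % suc Q) toℕ-s ⟨
      (toℕ y + toℕ s * toℕ j) % suc Q             ∎)
    where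
      open ≡-Reasoning
      d slope : ℕ
      d = toℕ i ∸ toℕ j
      slope = f * (toℕ x + Q * toℕ y) % suc Q
      s : Fin (suc Q)
      s = fromℕ< (m%n<n (f * (toℕ x + Q * toℕ y)) (suc Q))
      toℕ-s : toℕ s ≡ slope
      toℕ-s = toℕ-fromℕ< _
      i≡j+d : toℕ j + d ≡ toℕ i
      i≡j+d = m+[n∸m]≡n (<⇒≤ j<i)

  transversalCover : DivisibleBelow t Q → PairCover t (Fin t × Fin (suc Q)) (suc Q) (_≢_ on proj₁)
  transversalCover divisible = record
    { Block              = ℕ × ℕ
    ; block              = line
    ; block-injective    = toℕ-injective ∘ ,-injectiveʳ
    ; position           = λ _ → proj₁
    ; position-injective = line-position-injective
    ; covers             = line-covers
    }
    where
      line-covers : ∀ (p p′ : Fin t × Fin (suc Q)) → p ≢ p′ → proj₁ p ≢ proj₁ p′ →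
                    ∃₂ λ s s′ → line p s ≡ line p′ s′
      line-covers (i , x) (j , y) _ i≢j with <-cmp i j
      ... | tri< i<j _ _ = let s , through = line-through divisible y x i<j in s , s , sym through
      ... | tri≈ _ i≡j _ = ⊥-elim (i≢j i≡j)
      ... | tri> _ _ j<i = let s , through = line-through divisible x y j<i in s , s , through

refine : ∀ {t Q n k} → DivisibleBelow t Q → n ≤ t * suc Q →
         PairCover t (Fin (suc Q)) k Always → PairCover t (Fin n) (suc Q + k) Always
refine {t} {Q} {n} divisible n≤tq cover =
  weaken same-row? (restrict embed embed-injective (union (transversalCover divisible) (rowwise cover)))
  where
    embed : Fin n → Fin t × Fin (suc Q)
    embed v = remQuot (suc Q) (inject≤ v n≤tq)

    embed-injective : Injective _≡_ _≡_ embed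
    embed-injective same = inject≤-injective n≤tq n≤tq _ _ (remQuot-injective {t} (suc Q) same)

    same-row? : Always ⇒ (((_≢_ on proj₁) ∪ (_≡_ on proj₁)) on embed)
    same-row? {x} {y} _ with proj₁ (embed x) ≟ proj₁ (embed y)
    ... | yes same = inj₂ same
    ... | no  apart = inj₁ apart

m≤n⇒m∣n! : ∀ {m n} → 0 < m → m ≤ n → m ∣ n !
m≤n⇒m∣n! {suc m} _ m≤n = ∣-trans (m∣m*n (m !)) (m≤n⇒m!∣n! m≤n)

-- Rows have length suc (Q n) ≡ 1 (mod M), with n < t · suc (Q n) ≤ n + K. The slack a trades
-- the ratio (a + 1) / a against the additive constant E that absorbs the base case n < N₀.
module Recursion (t₀ M : ℕ) .{{_ : NonZero M}} (divisible : DivisibleBelow (2 + t₀) M) (a : ℕ) where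

  t c K N₀ E : ℕ
  t  = 2 + t₀
  c  = suc (a * t)
  K  = t * M + t
  N₀ = suc (c * K)
  E  = a * suc t₀ * N₀

  private instance
    tM≢0 : NonZero (t * M)
    tM≢0 = m*n≢0 t M

  Q : ℕ → ℕ
  Q n = (n / (t * M) + 1) * M

  Q-divisible : ∀ n → DivisibleBelow t (Q n)
  Q-divisible n 0<d d<t = ∣-trans (divisible 0<d d<t) (n∣m*n (n / (t * M) + 1))

  t*q≡ : ∀ n → t * suc (Q n) ≡ n / (t * M) * (t * M) + K
  t*q≡ n = expand (n / (t * M)) t M
    where
      expand : ∀ c t M → t * suc ((c + 1) * M) ≡ c * (t * M) + (t * M + t)
      expand = solve-∀

  n<t*q : ∀ n → n < t * suc (Q n)
  n<t*q n = begin-strict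
    n                                   ≡⟨ m≡m%n+[m/n]*n n (t * M) ⟩
    n % (t * M) + n / (t * M) * (t * M) <⟨ +-monoˡ-< _ (m%n<n n (t * M)) ⟩
    t * M + n / (t * M) * (t * M)       ≤⟨ +-monoˡ-≤ _ (m≤m+n (t * M) t) ⟩
    K + n / (t * M) * (t * M)           ≡⟨ +-comm K _ ⟩
    n / (t * M) * (t * M) + K           ≡⟨ t*q≡ n ⟨
    t * suc (Q n)                       ∎
    where open ≤-Reasoning

  t*q≤n+K : ∀ n → t * suc (Q n) ≤ n + K
  t*q≤n+K n = begin
    t * suc (Q n)             ≡⟨ t*q≡ n ⟩
    n / (t * M) * (t * M) + K ≤⟨ +-monoˡ-≤ K (m/n*n≤m n (t * M)) ⟩
    n + K                     ∎
    where open ≤-Reasoning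

  q<n : ∀ {n} → N₀ ≤ n → suc (Q n) < n
  q<n {n} N₀≤n = *-cancelˡ-< t _ _ (begin-strict
    t * suc (Q n)      ≤⟨ t*q≤n+K n ⟩
    n + K              <⟨ +-monoʳ-< n (<-≤-trans (s≤s (m≤m+n K (a * t * K))) N₀≤n) ⟩
    n + n              ≤⟨ +-monoʳ-≤ n (m≤m+n n (t₀ * n)) ⟩
    t * n              ∎)
    where open ≤-Reasoning

  c*q≤[1+a]*n : ∀ {n} → N₀ ≤ n → c * suc (Q n) ≤ suc a * n
  c*q≤[1+a]*n {n} N₀≤n = *-cancelˡ-≤ t (begin
    t * (c * suc (Q n))    ≡⟨ swap t c (suc (Q n)) ⟩
    c * (t * suc (Q n))    ≤⟨ *-monoʳ-≤ c (t*q≤n+K n) ⟩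
    c * (n + K)            ≡⟨ *-distribˡ-+ c n K ⟩
    c * n + c * K          ≤⟨ +-monoʳ-≤ (c * n) (≤-trans (n≤1+n (c * K)) N₀≤n) ⟩
    c * n + n              ≤⟨ +-monoʳ-≤ (c * n) (m≤m+n n (t₀ * n)) ⟩
    c * n + (n + t₀ * n)   ≡⟨ collect a t₀ n ⟩
    t * (suc a * n)        ∎)
    where
      open ≤-Reasoning
      swap : ∀ x y z → x * (y * z) ≡ y * (x * z)
      swap = solve-∀
      collect : ∀ a t₀ n → suc (a * (2 + t₀)) * n + (n + t₀ * n) ≡ (2 + t₀) * (suc a * n)
      collect = solve-∀

  Bounded : ℕ → Set₁
  Bounded n = Σ ℕ λ k → PairCover t (Fin n) k Always × a * suc t₀ * k ≤ suc a * n + E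

  small-bounded : ∀ {n} → n < N₀ → Bounded n
  small-bounded {n} n<N₀ = n , pairCover n , ≤-trans (*-monoʳ-≤ (a * suc t₀) (<⇒≤ n<N₀)) (m≤n+m E (suc a * n))

  refine-bounded : ∀ {n} → N₀ ≤ n → Bounded (suc (Q n)) → Bounded n
  refine-bounded {n} N₀≤n (k , cover , bound) =
    suc (Q n) + k , refine (Q-divisible n) (<⇒≤ (n<t*q n)) cover , (begin
      a * suc t₀ * (q + k)                ≡⟨ *-distribˡ-+ (a * suc t₀) q k ⟩
      a * suc t₀ * q + a * suc t₀ * k     ≤⟨ +-monoʳ-≤ (a * suc t₀ * q) bound ⟩
      a * suc t₀ * q + (suc a * q + E)    ≡⟨ collect a t₀ q E ⟩
      c * q + E                           ≤⟨ +-monoˡ-≤ E (c*q≤[1+a]*n N₀≤n) ⟩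
      suc a * n + E                       ∎)
    where
      open ≤-Reasoning
      q : ℕ
      q = suc (Q n)
      collect : ∀ a t₀ q E → a * suc t₀ * q + (suc a * q + E) ≡ suc (a * (2 + t₀)) * q + E
      collect = solve-∀

  bounded : ∀ n → Bounded n
  bounded = <-rec Bounded bounded′
    where
      bounded′ : ∀ n → (∀ {m} → m < n → Bounded m) → Bounded n
      bounded′ n rec with n <? N₀
      ... | yes n<N₀ = small-bounded n<N₀
      ... | no  n≮N₀ = refine-bounded (≮⇒≥ n≮N₀) (rec (q<n (≮⇒≥ n≮N₀)))

tighten-ratio : ∀ m c k r E → suc m * c * k ≤ suc (suc m) * suc r + E → m * E + m * (m + 2) ≤ r →
                m * c * k ≤ (m + 1) * r
tighten-ratio m c k r E bound r-large = *-cancelˡ-≤ (suc m) (begin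
  suc m * (m * c * k)                   ≡⟨ swap m c k ⟩
  m * (suc m * c * k)                   ≤⟨ *-monoʳ-≤ m bound ⟩
  m * (suc (suc m) * suc r + E)         ≡⟨ expand m r E ⟩
  (m * E + m * (m + 2)) + m * (m + 2) * r ≤⟨ +-monoˡ-≤ (m * (m + 2) * r) r-large ⟩
  r + m * (m + 2) * r                   ≡⟨ collect m r ⟩
  suc m * ((m + 1) * r)                 ∎)
  where
    open ≤-Reasoning
    swap : ∀ m c k → suc m * (m * c * k) ≡ m * (suc m * c * k)
    swap = solve-∀
    expand : ∀ m r E → m * (suc (suc m) * suc r + E) ≡ (m * E + m * (m + 2)) + m * (m + 2) * r
    expand = solve-∀
    collect : ∀ m r → r + m * (m + 2) * r ≡ suc m * ((m + 1) * r)
    collect = solve-∀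

theorem1p8 : (t : ℕ) → 2 ≤ t → (H : Graph) → Connected H → t < n H →
    (m : ℕ) → 0 < m →
    Σ ℕ λ R → ∀ r → R ≤ r → ∀ k → IsF r H k →
      m * (t ∸ 1) * k ≤ (m + 1) * (r ∸ 1)
theorem1p8 .(2 + t₀) (s≤s (s≤s {n = t₀} _)) H connected t<n m _ = suc (m * E + m * (m + 2)) , f-bound
  where
    open Recursion t₀ (suc t₀ !) {{suc t₀ !≢0}} (λ 0<d d<t → m≤n⇒m∣n! 0<d (s≤s⁻¹ d<t)) (suc m)
    f-bound : ∀ r → suc (m * E + m * (m + 2)) ≤ r → ∀ k → IsF r H k → m * suc t₀ * k ≤ (m + 1) * (r ∸ 1)
    f-bound (suc r) (s≤s r-large) k isF with bounded (suc r)
    ... | k′ , cover , k′-bound = tighten-ratio m (suc t₀) k r E k-bound r-large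
      where
        k-bound : suc m * suc t₀ * k ≤ suc (suc m) * suc r + E
        k-bound = ≤-trans (*-monoʳ-≤ (suc m * suc t₀) (f≤PairCover H connected t<n isF cover)) k′-bound
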